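{- Let $n$ and $d\geqslant2$ be positive integers with $\gcd(n,d)=1$. Let $r$ be an integer with $d-n\leqslant r\leqslant (d-1)n$ and $n\equiv -r\pmod d$. For $k\in\{1,2,\dots,\frac{(d-1)n-r}{d}\}$, write \[ \frac{1-q^{(d-1)n}}{1-q^{dk}}=\frac{C_k(q)}{D_k(q)}, \] where $C_k(q)$ and $D_k(q)$ are relatively prime polynomials in $q$. Then $D_k(q)$ is relatively prime to $1-q^n$. -}

module Defs where

open import Data.Nat using (ℕ; zero; suc)
open import Data.Rational using (ℚ; 0ℚ; 1ℚ; -_) renaming (_+_ to _+ℚ_; _*_ to _*ℚ_)
open import Data.List using (List; []; _∷_; map; replicate; _++_; [_])
open import Data.Product using (∃)
open import Relation.Binary.PropositionalEquality using (_≡_)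

-- Univariate polynomials over ℚ in the variable q, as coefficient lists,
-- lowest degree first.  Trailing zeros are allowed; equality of polynomials
-- is coefficientwise equality (_≈ₚ_), so representations are irrelevant.
Poly : Set
Poly = List ℚ

coeff : Poly → ℕ → ℚ
coeff []      _       = 0ℚ
coeff (a ∷ p) zero    = a
coeff (a ∷ p) (suc i) = coeff p i

_≈ₚ_ : Poly → Poly → Set
p ≈ₚ r = ∀ i → coeff p i ≡ coeff r i

infix 4 _≈ₚ_ _∣ₚ_
infixl 6 _+ₚ_ _-ₚ_
infixl 7 _*ₚ_

_+ₚ_ : Poly → Poly → Poly
[]      +ₚ r       = r
(a ∷ p) +ₚ []      = a ∷ p
(a ∷ p) +ₚ (b ∷ r) = (a +ℚ b) ∷ (p +ₚ r)

negₚ : Poly → Poly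
negₚ = map -_

_-ₚ_ : Poly → Poly → Poly
p -ₚ r = p +ₚ negₚ r

scaleₚ : ℚ → Poly → Poly
scaleₚ c = map (c *ℚ_)

_*ₚ_ : Poly → Poly → Poly
[]      *ₚ r = []
(a ∷ p) *ₚ r = scaleₚ a r +ₚ (0ℚ ∷ (p *ₚ r))

oneₚ : Poly
oneₚ = [ 1ℚ ]

qPow : ℕ → Poly
qPow m = replicate m 0ℚ ++ [ 1ℚ ]

oneMinusQPow : ℕ → Poly
oneMinusQPow m = oneₚ -ₚ qPow m

_∣ₚ_ : Poly → Poly → Set
g ∣ₚ p = ∃ λ h → h *ₚ g ≈ₚ p

IsUnitₚ : Poly → Set
IsUnitₚ g = ∃ λ u → u *ₚ g ≈ₚ oneₚ

RelPrimeₚ : Poly → Poly → Set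
RelPrimeₚ p r = ∀ g → g ∣ₚ p → g ∣ₚ r → IsUnitₚ g

{-# OPTIONS --safe #-}
module Submission where

-- Put X = 1 − q^(dk) and Y = 1 − q^((d−1)n), so that C·X = D·Y.  Euclid's
-- algorithm in ℚ[q] turns "every common divisor of C and D is a unit" into a
-- Bézout relation aC + bD = 1, whence X = D·(aY + bX).  A common factor g of
-- D and 1 − q^n divides Y, hence aY + bX, so g² divides X.  But 1 − q^N is
-- squarefree for N ≥ 1: the Euler operator θ = q·d/dq gives
-- θ(1 − q^N) = −N·q^N, so N·(1 − q^N) − θ(1 − q^N) = N, while g² ∣ 1 − q^N
-- forces g ∣ θ(1 − q^N).  Hence g divides the unit N.

open import Algebra.Bundles using (CommutativeRing)

-- Divisibility in commutative rings

module CommutativeRingDivisibility {c ℓ} (R : CommutativeRing c ℓ) where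

  open CommutativeRing R
  open import Algebra.Properties.CommutativeSemigroup *-commutativeSemigroup
    using (x∙yz≈y∙xz; xy∙z≈y∙xz)
  open import Algebra.Properties.CommutativeSemigroup.Divisibility *-commutativeSemigroup public
  open import Algebra.Properties.Semiring.Divisibility semiring public using (_∣0; ∣ʳ-refl)
  open import Algebra.Properties.Ring ring using (-‿distribˡ-*)
  open import Relation.Binary.Reasoning.Setoid setoid

  x∣y∧x∣z⇒x∣y+z : ∀ {x y z} → x ∣ʳ y → x ∣ʳ z → x ∣ʳ y + z
  x∣y∧x∣z⇒x∣y+z {x} (p , px≈y) (q , qx≈z) = p + q , trans (distribʳ x p q) (+-cong px≈y qx≈z)

  x∣y⇒x∣-y : ∀ {x y} → x ∣ʳ y → x ∣ʳ - y
  x∣y⇒x∣-y {x} (p , px≈y) = - p , trans (sym (-‿distribˡ-* p x)) (-‿cong px≈y)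

  X≈D*[aY+bX] : ∀ a b C D X Y → a * C + b * D ≈ 1# → C * X ≈ D * Y →
                X ≈ D * (a * Y + b * X)
  X≈D*[aY+bX] a b C D X Y aC+bD≈1 CX≈DY = begin
    X                           ≈⟨ *-identityˡ X ⟨
    1# * X                      ≈⟨ *-congʳ aC+bD≈1 ⟨
    (a * C + b * D) * X         ≈⟨ distribʳ X (a * C) (b * D) ⟩
    a * C * X + b * D * X       ≈⟨ +-cong (*-assoc a C X) (xy∙z≈y∙xz b D X) ⟩
    a * (C * X) + D * (b * X)   ≈⟨ +-congʳ (*-congˡ CX≈DY) ⟩
    a * (D * Y) + D * (b * X)   ≈⟨ +-congʳ (x∙yz≈y∙xz a D Y) ⟩
    D * (a * Y) + D * (b * X)   ≈⟨ distribˡ D (a * Y) (b * X) ⟨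
    D * (a * Y + b * X)         ∎

  x∣D∧x∣Y⇒x*x∣X : ∀ a b C D X Y {g} → a * C + b * D ≈ 1# → C * X ≈ D * Y →
                  g ∣ʳ D → g ∣ʳ Y → g * g ∣ʳ X
  x∣D∧x∣Y⇒x*x∣X a b C D X Y aC+bD≈1 CX≈DY g∣D g∣Y = ∣ʳ-respʳ-≈ (sym X≈DE) (∙-cong-∣ g∣D g∣E)
    where
    X≈DE = X≈D*[aY+bX] a b C D X Y aC+bD≈1 CX≈DY
    g∣X  = ∣ʳ-trans g∣D (xy≈z⇒x∣z D _ (sym X≈DE))
    g∣E  = x∣y∧x∣z⇒x∣y+z (x∣ʳy⇒x∣ʳzy a g∣Y) (x∣ʳy⇒x∣ʳzy b g∣X)

open import Defs
open import Algebra.Bundles using (CommutativeSemigroup)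
open import Algebra.Structures using (IsCommutativeRing)
import Algebra.Properties.CommutativeSemigroup as CommutativeSemigroupProperties
open import Data.List using ([]; _∷_; [_]; length)
open import Data.Maybe using (Maybe; just; nothing)
open import Data.Nat as ℕ using (ℕ; zero; suc; _∸_) renaming (_*_ to _*ℕ_; _≤_ to _≤ℕ_)
import Data.Nat.Properties as ℕₚ
open import Data.Product using (∃₂; _,_)
open import Data.Rational as ℚ using (ℚ; 0ℚ; 1ℚ; -_)
  renaming (_+_ to _+ℚ_; _*_ to _*ℚ_; _-_ to _-ℚ_)
import Data.Rational.Properties as ℚₚ
open import Algebra.Definitions.RawMonoid ℚ.+-0-rawMonoid using (_×_)
open import Relation.Binary.Bundles using (Setoid)
open import Relation.Binary.Structures using (IsEquivalence)
open import Relation.Binary.PropositionalEquality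
  using (_≡_; _≢_; refl; sym; trans; cong; cong₂; module ≡-Reasoning)
import Relation.Binary.PropositionalEquality as ≡
import Relation.Binary.Reasoning.Setoid as SetoidReasoning
open import Relation.Nullary using (¬_; yes; no)
open import Tactic.RingSolver using (solve-∀)
open import Tactic.RingSolver.Core.AlmostCommutativeRing
  using (AlmostCommutativeRing; fromCommutativeRing)

-- The ring ℚ[q]

infix 4 _≋_

-- _≈ₚ_ unfolds to a function type, from which Agda cannot infer the two
-- polynomials; the record wrapper makes them inferable.
record _≋_ (p r : Poly) : Set where
  constructor mk≋
  field coeff-≡ : p ≈ₚ r
open _≋_

≋-refl : ∀ {p} → p ≋ p
≋-refl = mk≋ λ _ → refl

≋-reflexive : ∀ {p r} → p ≡ r → p ≋ r
≋-reflexive refl = ≋-refl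

≋-sym : ∀ {p r} → p ≋ r → r ≋ p
≋-sym p≋r = mk≋ λ i → sym (coeff-≡ p≋r i)

≋-trans : ∀ {p r s} → p ≋ r → r ≋ s → p ≋ s
≋-trans p≋r r≋s = mk≋ λ i → trans (coeff-≡ p≋r i) (coeff-≡ r≋s i)

≋-isEquivalence : IsEquivalence _≋_
≋-isEquivalence = record { refl = ≋-refl ; sym = ≋-sym ; trans = ≋-trans }

≋-setoid : Setoid _ _
≋-setoid = record { isEquivalence = ≋-isEquivalence }

module ≋-Reasoning = SetoidReasoning ≋-setoid

coeff-+ₚ : ∀ p r i → coeff (p +ₚ r) i ≡ coeff p i +ℚ coeff r i
coeff-+ₚ []      r       i       = sym (ℚₚ.+-identityˡ (coeff r i))
coeff-+ₚ (a ∷ p) []      i       = sym (ℚₚ.+-identityʳ (coeff (a ∷ p) i))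
coeff-+ₚ (a ∷ p) (b ∷ r) zero    = refl
coeff-+ₚ (a ∷ p) (b ∷ r) (suc i) = coeff-+ₚ p r i

coeff-negₚ : ∀ p i → coeff (negₚ p) i ≡ - coeff p i
coeff-negₚ []      i       = refl
coeff-negₚ (a ∷ p) zero    = refl
coeff-negₚ (a ∷ p) (suc i) = coeff-negₚ p i

coeff-scaleₚ : ∀ c p i → coeff (scaleₚ c p) i ≡ c *ℚ coeff p i
coeff-scaleₚ c []      i       = sym (ℚₚ.*-zeroʳ c)
coeff-scaleₚ c (a ∷ p) zero    = refl
coeff-scaleₚ c (a ∷ p) (suc i) = coeff-scaleₚ c p i

coeff--ₚ : ∀ p r i → coeff (p -ₚ r) i ≡ coeff p i -ℚ coeff r i
coeff--ₚ p r i = trans (coeff-+ₚ p (negₚ r) i) (cong (coeff p i +ℚ_) (coeff-negₚ r i))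

∷-cong : ∀ {a b p r} → a ≡ b → p ≋ r → a ∷ p ≋ b ∷ r
∷-cong a≡b p≋r = mk≋ λ { zero → a≡b ; (suc i) → coeff-≡ p≋r i }

∷-≋-[] : ∀ {a p} → a ≡ 0ℚ → p ≋ [] → a ∷ p ≋ []
∷-≋-[] a≡0 p≋[] = mk≋ λ { zero → a≡0 ; (suc i) → coeff-≡ p≋[] i }

+ₚ-cong : ∀ {p p′ r r′} → p ≋ p′ → r ≋ r′ → p +ₚ r ≋ p′ +ₚ r′
+ₚ-cong {p} {p′} {r} {r′} p≋p′ r≋r′ = mk≋ λ i → begin
  coeff (p +ₚ r) i            ≡⟨ coeff-+ₚ p r i ⟩
  coeff p i +ℚ coeff r i      ≡⟨ cong₂ _+ℚ_ (coeff-≡ p≋p′ i) (coeff-≡ r≋r′ i) ⟩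
  coeff p′ i +ℚ coeff r′ i    ≡⟨ coeff-+ₚ p′ r′ i ⟨
  coeff (p′ +ₚ r′) i          ∎
  where open ≡-Reasoning

negₚ-cong : ∀ {p p′} → p ≋ p′ → negₚ p ≋ negₚ p′
negₚ-cong {p} {p′} p≋p′ = mk≋ λ i → begin
  coeff (negₚ p) i    ≡⟨ coeff-negₚ p i ⟩
  - coeff p i         ≡⟨ cong -_ (coeff-≡ p≋p′ i) ⟩
  - coeff p′ i        ≡⟨ coeff-negₚ p′ i ⟨
  coeff (negₚ p′) i   ∎
  where open ≡-Reasoning

scaleₚ-cong : ∀ c {p p′} → p ≋ p′ → scaleₚ c p ≋ scaleₚ c p′
scaleₚ-cong c {p} {p′} p≋p′ = mk≋ λ i → begin
  coeff (scaleₚ c p) i    ≡⟨ coeff-scaleₚ c p i ⟩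
  c *ℚ coeff p i          ≡⟨ cong (c *ℚ_) (coeff-≡ p≋p′ i) ⟩
  c *ℚ coeff p′ i         ≡⟨ coeff-scaleₚ c p′ i ⟨
  coeff (scaleₚ c p′) i   ∎
  where open ≡-Reasoning

+ₚ-identityʳ : ∀ p → p +ₚ [] ≡ p
+ₚ-identityʳ []      = refl
+ₚ-identityʳ (a ∷ p) = refl

+ₚ-comm : ∀ p r → p +ₚ r ≡ r +ₚ p
+ₚ-comm []      r       = sym (+ₚ-identityʳ r)
+ₚ-comm (a ∷ p) []      = refl
+ₚ-comm (a ∷ p) (b ∷ r) = cong₂ _∷_ (ℚₚ.+-comm a b) (+ₚ-comm p r)

+ₚ-assoc : ∀ p r s → (p +ₚ r) +ₚ s ≡ p +ₚ (r +ₚ s)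
+ₚ-assoc []      r       s       = refl
+ₚ-assoc (a ∷ p) []      s       = refl
+ₚ-assoc (a ∷ p) (b ∷ r) []      = refl
+ₚ-assoc (a ∷ p) (b ∷ r) (c ∷ s) = cong₂ _∷_ (ℚₚ.+-assoc a b c) (+ₚ-assoc p r s)

+ₚ-inverseʳ : ∀ p → p +ₚ negₚ p ≋ []
+ₚ-inverseʳ []      = ≋-refl
+ₚ-inverseʳ (a ∷ p) = ∷-≋-[] (ℚₚ.+-inverseʳ a) (+ₚ-inverseʳ p)

+ₚ-commutativeSemigroup : CommutativeSemigroup _ _
+ₚ-commutativeSemigroup = record
  { isCommutativeSemigroup = record
    { isSemigroup = record
      { isMagma = record { isEquivalence = ≡.isEquivalence ; ∙-cong = cong₂ _+ₚ_ }
      ; assoc   = +ₚ-assoc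
      }
    ; comm = +ₚ-comm
    }
  }

open CommutativeSemigroupProperties +ₚ-commutativeSemigroup
  using () renaming (interchange to +ₚ-interchange; x∙yz≈y∙xz to +ₚ-left-comm)

scaleₚ-zeroˡ : ∀ p → scaleₚ 0ℚ p ≋ []
scaleₚ-zeroˡ []      = ≋-refl
scaleₚ-zeroˡ (a ∷ p) = ∷-≋-[] (ℚₚ.*-zeroˡ a) (scaleₚ-zeroˡ p)

scaleₚ-identityˡ : ∀ p → scaleₚ 1ℚ p ≡ p
scaleₚ-identityˡ []      = refl
scaleₚ-identityˡ (a ∷ p) = cong₂ _∷_ (ℚₚ.*-identityˡ a) (scaleₚ-identityˡ p)

scaleₚ-assoc : ∀ a b p → scaleₚ a (scaleₚ b p) ≡ scaleₚ (a *ℚ b) p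
scaleₚ-assoc a b []      = refl
scaleₚ-assoc a b (c ∷ p) = cong₂ _∷_ (sym (ℚₚ.*-assoc a b c)) (scaleₚ-assoc a b p)

scaleₚ-distribˡ : ∀ c p r → scaleₚ c (p +ₚ r) ≡ scaleₚ c p +ₚ scaleₚ c r
scaleₚ-distribˡ c []      r       = refl
scaleₚ-distribˡ c (a ∷ p) []      = refl
scaleₚ-distribˡ c (a ∷ p) (b ∷ r) = cong₂ _∷_ (ℚₚ.*-distribˡ-+ c a b) (scaleₚ-distribˡ c p r)

0∷-+ₚ : ∀ p r → 0ℚ ∷ (p +ₚ r) ≡ (0ℚ ∷ p) +ₚ (0ℚ ∷ r)
0∷-+ₚ p r = cong (_∷ (p +ₚ r)) (sym (ℚₚ.+-identityˡ 0ℚ))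

0∷-*ₚ : ∀ p r → (0ℚ ∷ p) *ₚ r ≋ 0ℚ ∷ (p *ₚ r)
0∷-*ₚ p r = +ₚ-cong (scaleₚ-zeroˡ r) ≋-refl

*ₚ-zeroʳ : ∀ p → p *ₚ [] ≋ []
*ₚ-zeroʳ []      = ≋-refl
*ₚ-zeroʳ (a ∷ p) = ∷-≋-[] refl (*ₚ-zeroʳ p)

*ₚ-congˡ : ∀ p {r r′} → r ≋ r′ → p *ₚ r ≋ p *ₚ r′
*ₚ-congˡ []      r≋r′ = ≋-refl
*ₚ-congˡ (a ∷ p) r≋r′ = +ₚ-cong (scaleₚ-cong a r≋r′) (∷-cong refl (*ₚ-congˡ p r≋r′))

*ₚ-distribˡ : ∀ p r s → p *ₚ (r +ₚ s) ≡ p *ₚ r +ₚ p *ₚ s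
*ₚ-distribˡ []      r s = refl
*ₚ-distribˡ (a ∷ p) r s = begin
  scaleₚ a (r +ₚ s) +ₚ (0ℚ ∷ p *ₚ (r +ₚ s))
    ≡⟨ cong₂ _+ₚ_ (scaleₚ-distribˡ a r s) (cong (0ℚ ∷_) (*ₚ-distribˡ p r s)) ⟩
  (scaleₚ a r +ₚ scaleₚ a s) +ₚ (0ℚ ∷ (p *ₚ r +ₚ p *ₚ s))
    ≡⟨ cong (scaleₚ a r +ₚ scaleₚ a s +ₚ_) (0∷-+ₚ (p *ₚ r) (p *ₚ s)) ⟩
  (scaleₚ a r +ₚ scaleₚ a s) +ₚ ((0ℚ ∷ p *ₚ r) +ₚ (0ℚ ∷ p *ₚ s))
    ≡⟨ +ₚ-interchange (scaleₚ a r) (scaleₚ a s) _ _ ⟩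
  (scaleₚ a r +ₚ (0ℚ ∷ p *ₚ r)) +ₚ (scaleₚ a s +ₚ (0ℚ ∷ p *ₚ s))
    ∎
  where open ≡-Reasoning

*ₚ-∷ʳ : ∀ p b r → p *ₚ (b ∷ r) ≋ scaleₚ b p +ₚ (0ℚ ∷ p *ₚ r)
*ₚ-∷ʳ []      b r = ≋-sym (∷-≋-[] refl ≋-refl)
*ₚ-∷ʳ (a ∷ p) b r = ∷-cong (cong (_+ℚ 0ℚ) (ℚₚ.*-comm a b)) (begin
  scaleₚ a r +ₚ p *ₚ (b ∷ r)                        ≈⟨ +ₚ-cong ≋-refl (*ₚ-∷ʳ p b r) ⟩
  scaleₚ a r +ₚ (scaleₚ b p +ₚ (0ℚ ∷ p *ₚ r))       ≡⟨ +ₚ-left-comm (scaleₚ a r) (scaleₚ b p) _ ⟩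
  scaleₚ b p +ₚ (scaleₚ a r +ₚ (0ℚ ∷ p *ₚ r))       ∎)
  where open ≋-Reasoning

*ₚ-comm : ∀ p r → p *ₚ r ≋ r *ₚ p
*ₚ-comm []      r = ≋-sym (*ₚ-zeroʳ r)
*ₚ-comm (a ∷ p) r = ≋-trans (+ₚ-cong ≋-refl (∷-cong refl (*ₚ-comm p r))) (≋-sym (*ₚ-∷ʳ r a p))

scaleₚ-*ₚ : ∀ c p r → scaleₚ c p *ₚ r ≡ scaleₚ c (p *ₚ r)
scaleₚ-*ₚ c []      r = refl
scaleₚ-*ₚ c (a ∷ p) r = begin
  scaleₚ (c *ℚ a) r +ₚ (0ℚ ∷ scaleₚ c p *ₚ r)
    ≡⟨ cong₂ _+ₚ_ (scaleₚ-assoc c a r) (cong₂ _∷_ (ℚₚ.*-zeroʳ c) (sym (scaleₚ-*ₚ c p r))) ⟨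
  scaleₚ c (scaleₚ a r) +ₚ scaleₚ c (0ℚ ∷ p *ₚ r)
    ≡⟨ scaleₚ-distribˡ c (scaleₚ a r) _ ⟨
  scaleₚ c (scaleₚ a r +ₚ (0ℚ ∷ p *ₚ r))
    ∎
  where open ≡-Reasoning

*ₚ-congʳ : ∀ {p p′} r → p ≋ p′ → p *ₚ r ≋ p′ *ₚ r
*ₚ-congʳ {p} {p′} r p≋p′ = begin
  p *ₚ r    ≈⟨ *ₚ-comm p r ⟩
  r *ₚ p    ≈⟨ *ₚ-congˡ r p≋p′ ⟩
  r *ₚ p′   ≈⟨ *ₚ-comm r p′ ⟩
  p′ *ₚ r   ∎
  where open ≋-Reasoning

*ₚ-distribʳ : ∀ r p p′ → (p +ₚ p′) *ₚ r ≋ p *ₚ r +ₚ p′ *ₚ r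
*ₚ-distribʳ r p p′ = begin
  (p +ₚ p′) *ₚ r         ≈⟨ *ₚ-comm (p +ₚ p′) r ⟩
  r *ₚ (p +ₚ p′)         ≡⟨ *ₚ-distribˡ r p p′ ⟩
  r *ₚ p +ₚ r *ₚ p′      ≈⟨ +ₚ-cong (*ₚ-comm r p) (*ₚ-comm r p′) ⟩
  p *ₚ r +ₚ p′ *ₚ r      ∎
  where open ≋-Reasoning

*ₚ-assoc : ∀ p r s → (p *ₚ r) *ₚ s ≋ p *ₚ (r *ₚ s)
*ₚ-assoc []      r s = ≋-refl
*ₚ-assoc (a ∷ p) r s = begin
  (scaleₚ a r +ₚ (0ℚ ∷ p *ₚ r)) *ₚ s            ≈⟨ *ₚ-distribʳ s (scaleₚ a r) _ ⟩
  scaleₚ a r *ₚ s +ₚ (0ℚ ∷ p *ₚ r) *ₚ s         ≈⟨ +ₚ-cong (≋-reflexive (scaleₚ-*ₚ a r s)) (0∷-*ₚ (p *ₚ r) s) ⟩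
  scaleₚ a (r *ₚ s) +ₚ (0ℚ ∷ (p *ₚ r) *ₚ s)     ≈⟨ +ₚ-cong ≋-refl (∷-cong refl (*ₚ-assoc p r s)) ⟩
  scaleₚ a (r *ₚ s) +ₚ (0ℚ ∷ p *ₚ (r *ₚ s))     ∎
  where open ≋-Reasoning

*ₚ-identityˡ : ∀ p → oneₚ *ₚ p ≋ p
*ₚ-identityˡ p = begin
  scaleₚ 1ℚ p +ₚ (0ℚ ∷ [])   ≈⟨ +ₚ-cong ≋-refl (∷-≋-[] refl ≋-refl) ⟩
  scaleₚ 1ℚ p +ₚ []          ≡⟨ +ₚ-identityʳ (scaleₚ 1ℚ p) ⟩
  scaleₚ 1ℚ p                ≡⟨ scaleₚ-identityˡ p ⟩
  p                          ∎
  where open ≋-Reasoning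

open import Algebra.Consequences.Setoid ≋-setoid
  using (comm∧idˡ⇒id; comm∧invʳ⇒inv; comm∧distrˡ⇒distr)

+ₚ-*ₚ-isCommutativeRing : IsCommutativeRing _≋_ _+ₚ_ _*ₚ_ negₚ [] oneₚ
+ₚ-*ₚ-isCommutativeRing = record
  { isRing = record
    { +-isAbelianGroup = record
      { isGroup = record
        { isMonoid = record
          { isSemigroup = record
            { isMagma = record { isEquivalence = ≋-isEquivalence ; ∙-cong = +ₚ-cong }
            ; assoc   = λ p r s → ≋-reflexive (+ₚ-assoc p r s)
            }
          ; identity = comm∧idˡ⇒id +ₚ-comm≋ (λ _ → ≋-refl)
          }
        ; inverse = comm∧invʳ⇒inv +ₚ-comm≋ +ₚ-inverseʳ
        ; ⁻¹-cong = negₚ-cong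
        }
      ; comm = +ₚ-comm≋
      }
    ; *-cong     = λ {p} {p′} {r} p≋p′ r≋r′ → ≋-trans (*ₚ-congʳ r p≋p′) (*ₚ-congˡ p′ r≋r′)
    ; *-assoc    = *ₚ-assoc
    ; *-identity = comm∧idˡ⇒id *ₚ-comm *ₚ-identityˡ
    ; distrib    = comm∧distrˡ⇒distr +ₚ-cong *ₚ-comm (λ p r s → ≋-reflexive (*ₚ-distribˡ p r s))
    }
  ; *-comm = *ₚ-comm
  }
  where
  +ₚ-comm≋ : ∀ p r → p +ₚ r ≋ r +ₚ p
  +ₚ-comm≋ p r = ≋-reflexive (+ₚ-comm p r)

ℚ[q] : CommutativeRing _ _
ℚ[q] = record { isCommutativeRing = +ₚ-*ₚ-isCommutativeRing }

-- The solver treats polynomial constants such as oneₚ as coefficients; it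
-- needs this zero test to cancel them.
[]≋? : ∀ p → Maybe ([] ≋ p)
[]≋? []      = just ≋-refl
[]≋? (a ∷ p) with 0ℚ ℚₚ.≟ a | []≋? p
... | yes 0≡a | just []≋p = just (≋-sym (∷-≋-[] (sym 0≡a) (≋-sym []≋p)))
... | _       | _         = nothing

ℚ[q]-almostCommutativeRing : AlmostCommutativeRing _ _
ℚ[q]-almostCommutativeRing = fromCommutativeRing ℚ[q] []≋?

open CommutativeRingDivisibility ℚ[q] hiding (_∣_)

∣ₚ⇒∣ʳ : ∀ {g p} → g ∣ₚ p → g ∣ʳ p
∣ₚ⇒∣ʳ (h , hg≈p) = h , mk≋ hg≈p

∣ʳ⇒∣ₚ : ∀ {g p} → g ∣ʳ p → g ∣ₚ p
∣ʳ⇒∣ₚ (h , hg≋p) = h , coeff-≡ hg≋p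

qPow-+ : ∀ a b → qPow (a ℕ.+ b) ≋ qPow a *ₚ qPow b
qPow-+ zero    b = ≋-sym (*ₚ-identityˡ (qPow b))
qPow-+ (suc a) b = ≋-trans (∷-cong refl (qPow-+ a b)) (≋-sym (0∷-*ₚ (qPow a) (qPow b)))

oneMinusQPow-+ : ∀ a b → oneMinusQPow (a ℕ.+ b) ≋ oneMinusQPow b +ₚ qPow b *ₚ oneMinusQPow a
oneMinusQPow-+ a b = ≋-trans (+ₚ-cong ≋-refl (negₚ-cong (qPow-+ a b))) (regroup (qPow a) (qPow b))
  where
  regroup : ∀ A B → oneₚ -ₚ A *ₚ B ≋ (oneₚ -ₚ B) +ₚ B *ₚ (oneₚ -ₚ A)
  regroup = solve-∀ ℚ[q]-almostCommutativeRing

oneMinusQPow-∣-* : ∀ m n → oneMinusQPow n ∣ʳ oneMinusQPow (m *ℕ n)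
oneMinusQPow-∣-* zero    n = ∣ʳ-respʳ-≈ (≋-sym (+ₚ-inverseʳ oneₚ)) (oneMinusQPow n ∣0)
oneMinusQPow-∣-* (suc m) n = ∣ʳ-respʳ-≈ (≋-sym (oneMinusQPow-+ n (m *ℕ n)))
  (x∣y∧x∣z⇒x∣y+z (oneMinusQPow-∣-* m n) (x∣ʳy⇒x∣ʳzy (qPow (m *ℕ n)) ∣ʳ-refl))

-- The Euler operator and squarefreeness of 1 − q^N

0∷≋q*ₚ : ∀ p → 0ℚ ∷ p ≋ qPow 1 *ₚ p
0∷≋q*ₚ p = ≋-sym (≋-trans (0∷-*ₚ oneₚ p) (∷-cong refl (*ₚ-identityˡ p)))

scaleₚ≋[c]*ₚ : ∀ c p → scaleₚ c p ≋ [ c ] *ₚ p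
scaleₚ≋[c]*ₚ c p = ≋-sym (≋-trans (+ₚ-cong ≋-refl (∷-≋-[] refl ≋-refl)) (≋-reflexive (+ₚ-identityʳ (scaleₚ c p))))

∷≋[a]+q*ₚ : ∀ a p → a ∷ p ≋ [ a ] +ₚ qPow 1 *ₚ p
∷≋[a]+q*ₚ a p = ≋-trans (∷-cong (sym (ℚₚ.+-identityʳ a)) ≋-refl) (+ₚ-cong {[ a ]} ≋-refl (0∷≋q*ₚ p))

-- θ is the Euler operator q·d/dq; θ-from i weights the coefficient of q^j by
-- i + j.
θ-from : ℕ → Poly → Poly
θ-from i []      = []
θ-from i (a ∷ p) = (i × 1ℚ) *ℚ a ∷ θ-from (suc i) p

θ : Poly → Poly
θ = θ-from 0

coeff-θ-from : ∀ i p j → coeff (θ-from i p) j ≡ ((i ℕ.+ j) × 1ℚ) *ℚ coeff p j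
coeff-θ-from i []      j       = sym (ℚₚ.*-zeroʳ ((i ℕ.+ j) × 1ℚ))
coeff-θ-from i (a ∷ p) zero    = cong (λ k → (k × 1ℚ) *ℚ a) (sym (ℕₚ.+-identityʳ i))
coeff-θ-from i (a ∷ p) (suc j) =
  trans (coeff-θ-from (suc i) p j) (cong (λ k → (k × 1ℚ) *ℚ coeff p j) (sym (ℕₚ.+-suc i j)))

θ-cong : ∀ {p r} → p ≋ r → θ p ≋ θ r
θ-cong {p} {r} p≋r = mk≋ λ j → begin
  coeff (θ p) j              ≡⟨ coeff-θ-from 0 p j ⟩
  (j × 1ℚ) *ℚ coeff p j      ≡⟨ cong ((j × 1ℚ) *ℚ_) (coeff-≡ p≋r j) ⟩
  (j × 1ℚ) *ℚ coeff r j      ≡⟨ coeff-θ-from 0 r j ⟨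
  coeff (θ r) j              ∎
  where open ≡-Reasoning

θ-from-+ₚ : ∀ i p r → θ-from i (p +ₚ r) ≡ θ-from i p +ₚ θ-from i r
θ-from-+ₚ i []      r       = refl
θ-from-+ₚ i (a ∷ p) []      = refl
θ-from-+ₚ i (a ∷ p) (b ∷ r) = cong₂ _∷_ (ℚₚ.*-distribˡ-+ (i × 1ℚ) a b) (θ-from-+ₚ (suc i) p r)

θ-from-negₚ : ∀ i p → θ-from i (negₚ p) ≡ negₚ (θ-from i p)
θ-from-negₚ i []      = refl
θ-from-negₚ i (a ∷ p) = cong₂ _∷_ (sym (ℚₚ.neg-distribʳ-* (i × 1ℚ) a)) (θ-from-negₚ (suc i) p)

θ-from-scaleₚ : ∀ i c p → θ-from i (scaleₚ c p) ≡ scaleₚ c (θ-from i p)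
θ-from-scaleₚ i c []      = refl
θ-from-scaleₚ i c (a ∷ p) = cong₂ _∷_ (ℚ-*-left-comm (i × 1ℚ) c a) (θ-from-scaleₚ (suc i) c p)
  where open CommutativeSemigroupProperties (CommutativeRing.*-commutativeSemigroup ℚₚ.+-*-commutativeRing)
          using () renaming (x∙yz≈y∙xz to ℚ-*-left-comm)

θ-from-suc : ∀ i p → θ-from (suc i) p ≡ θ-from i p +ₚ p
θ-from-suc i []      = refl
θ-from-suc i (a ∷ p) = cong₂ _∷_ (1+w*a≡w*a+a (i × 1ℚ)) (θ-from-suc (suc i) p)
  where
  1+w*a≡w*a+a : ∀ w → (1ℚ +ℚ w) *ℚ a ≡ w *ℚ a +ℚ a
  1+w*a≡w*a+a w = begin
    (1ℚ +ℚ w) *ℚ a         ≡⟨ ℚₚ.*-distribʳ-+ a 1ℚ w ⟩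
    1ℚ *ℚ a +ℚ w *ℚ a      ≡⟨ ℚₚ.+-comm (1ℚ *ℚ a) (w *ℚ a) ⟩
    w *ℚ a +ℚ 1ℚ *ℚ a      ≡⟨ cong (w *ℚ a +ℚ_) (ℚₚ.*-identityˡ a) ⟩
    w *ℚ a +ℚ a            ∎
    where open ≡-Reasoning

θ-∷ : ∀ a p → θ (a ∷ p) ≋ 0ℚ ∷ (θ p +ₚ p)
θ-∷ a p = ∷-cong (ℚₚ.*-zeroˡ a) (≋-reflexive (θ-from-suc 0 p))

θ-*ₚ : ∀ p s → θ (p *ₚ s) ≋ θ p *ₚ s +ₚ p *ₚ θ s
θ-*ₚ []      s = ≋-refl
θ-*ₚ (a ∷ p) s = begin
  θ (scaleₚ a s +ₚ (0ℚ ∷ p *ₚ s))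
    ≡⟨ θ-from-+ₚ 0 (scaleₚ a s) (0ℚ ∷ p *ₚ s) ⟩
  θ (scaleₚ a s) +ₚ θ (0ℚ ∷ p *ₚ s)
    ≈⟨ +ₚ-cong (≋-reflexive (θ-from-scaleₚ 0 a s)) (θ-∷ 0ℚ (p *ₚ s)) ⟩
  scaleₚ a (θ s) +ₚ (0ℚ ∷ (θ (p *ₚ s) +ₚ p *ₚ s))
    ≈⟨ +ₚ-cong (scaleₚ≋[c]*ₚ a (θ s)) (≋-trans (∷-cong refl (+ₚ-cong (θ-*ₚ p s) ≋-refl)) (0∷≋q*ₚ _)) ⟩
  [ a ] *ₚ θ s +ₚ qPow 1 *ₚ ((θ p *ₚ s +ₚ p *ₚ θ s) +ₚ p *ₚ s)
    ≈⟨ regroup [ a ] (qPow 1) p s (θ p) (θ s) ⟩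
  (qPow 1 *ₚ (θ p +ₚ p)) *ₚ s +ₚ ([ a ] +ₚ qPow 1 *ₚ p) *ₚ θ s
    ≈⟨ +ₚ-cong (*ₚ-congʳ s (≋-trans (θ-∷ a p) (0∷≋q*ₚ _))) (*ₚ-congʳ (θ s) (∷≋[a]+q*ₚ a p)) ⟨
  θ (a ∷ p) *ₚ s +ₚ (a ∷ p) *ₚ θ s
    ∎
  where
  open ≋-Reasoning
  regroup : ∀ A Q p s θp θs →
            A *ₚ θs +ₚ Q *ₚ ((θp *ₚ s +ₚ p *ₚ θs) +ₚ p *ₚ s) ≋
            (Q *ₚ (θp +ₚ p)) *ₚ s +ₚ (A +ₚ Q *ₚ p) *ₚ θs
  regroup = solve-∀ ℚ[q]-almostCommutativeRing

θ-from-qPow : ∀ i N → θ-from i (qPow N) ≡ scaleₚ ((i ℕ.+ N) × 1ℚ) (qPow N)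
θ-from-qPow i zero    = cong (λ k → [ (k × 1ℚ) *ℚ 1ℚ ]) (sym (ℕₚ.+-identityʳ i))
θ-from-qPow i (suc N) = cong₂ _∷_
  (trans (ℚₚ.*-zeroʳ (i × 1ℚ)) (sym (ℚₚ.*-zeroʳ ((i ℕ.+ suc N) × 1ℚ))))
  (trans (θ-from-qPow (suc i) N) (cong (λ k → scaleₚ (k × 1ℚ) (qPow N)) (sym (ℕₚ.+-suc i N))))

θ-oneMinusQPow : ∀ N → θ (oneMinusQPow N) ≋ negₚ ([ N × 1ℚ ] *ₚ qPow N)
θ-oneMinusQPow N = begin
  θ (oneₚ +ₚ negₚ (qPow N))                  ≡⟨ θ-from-+ₚ 0 oneₚ (negₚ (qPow N)) ⟩
  [ 0ℚ ] +ₚ θ (negₚ (qPow N))                ≈⟨ +ₚ-cong (∷-≋-[] refl ≋-refl) ≋-refl ⟩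
  θ (negₚ (qPow N))                          ≡⟨ θ-from-negₚ 0 (qPow N) ⟩
  negₚ (θ (qPow N))                          ≡⟨ cong negₚ (θ-from-qPow 0 N) ⟩
  negₚ (scaleₚ (N × 1ℚ) (qPow N))            ≈⟨ negₚ-cong (scaleₚ≋[c]*ₚ (N × 1ℚ) (qPow N)) ⟩
  negₚ ([ N × 1ℚ ] *ₚ qPow N)                ∎
  where open ≋-Reasoning

x*x∣p⇒x∣θp : ∀ {g p} → g *ₚ g ∣ʳ p → g ∣ʳ θ p
x*x∣p⇒x∣θp {g} {p} (h , h[gg]≋p) = θ (h *ₚ g) +ₚ h *ₚ θ g , (begin
  (θ (h *ₚ g) +ₚ h *ₚ θ g) *ₚ g         ≈⟨ regroup (θ (h *ₚ g)) h g (θ g) ⟩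
  θ (h *ₚ g) *ₚ g +ₚ (h *ₚ g) *ₚ θ g    ≈⟨ θ-*ₚ (h *ₚ g) g ⟨
  θ ((h *ₚ g) *ₚ g)                     ≈⟨ θ-cong (*ₚ-assoc h g g) ⟩
  θ (h *ₚ (g *ₚ g))                     ≈⟨ θ-cong h[gg]≋p ⟩
  θ p                                   ∎)
  where
  open ≋-Reasoning
  regroup : ∀ θhg h g θg → (θhg +ₚ h *ₚ θg) *ₚ g ≋ θhg *ₚ g +ₚ (h *ₚ g) *ₚ θg
  regroup = solve-∀ ℚ[q]-almostCommutativeRing

[c]∣oneₚ : ∀ c .{{_ : ℚ.NonZero c}} → [ c ] ∣ʳ oneₚ
[c]∣oneₚ c = [ ℚ.1/ c ] , ∷-cong (trans (ℚₚ.+-identityʳ _) (ℚₚ.*-inverseˡ c)) ≋-refl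

suc×1ℚ-positive : ∀ N → ℚ.Positive (suc N × 1ℚ)
suc×1ℚ-positive zero    = _
suc×1ℚ-positive (suc N) = ℚₚ.pos+pos⇒pos 1ℚ (suc N × 1ℚ) {{suc×1ℚ-positive N}}

×1ℚ-nonZero : ∀ N .{{_ : ℕ.NonZero N}} → ℚ.NonZero (N × 1ℚ)
×1ℚ-nonZero (suc N) = ℚₚ.pos⇒nonZero (suc N × 1ℚ) {{suc×1ℚ-positive N}}

oneMinusQPow-squarefree : ∀ N .{{_ : ℕ.NonZero N}} {g} → g *ₚ g ∣ʳ oneMinusQPow N → g ∣ʳ oneₚ
oneMinusQPow-squarefree N {g} g²∣X = ∣ʳ-trans g∣N̂ ([c]∣oneₚ (N × 1ℚ) {{×1ℚ-nonZero N}})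
  where
  N̂ = [ N × 1ℚ ]
  X = oneMinusQPow N

  N̂X-θX≋N̂ : N̂ *ₚ X -ₚ θ X ≋ N̂
  N̂X-θX≋N̂ = ≋-trans (+ₚ-cong ≋-refl (negₚ-cong (θ-oneMinusQPow N))) (cancel N̂ (qPow N))
    where
    cancel : ∀ K Q → K *ₚ (oneₚ -ₚ Q) -ₚ negₚ (K *ₚ Q) ≋ K
    cancel = solve-∀ ℚ[q]-almostCommutativeRing

  g∣X : g ∣ʳ X
  g∣X = ∣ʳ-trans (x∣ʳyx g g) g²∣X

  g∣N̂ : g ∣ʳ N̂
  g∣N̂ = ∣ʳ-respʳ-≈ N̂X-θX≋N̂ (x∣y∧x∣z⇒x∣y+z (x∣ʳy⇒x∣ʳzy N̂ g∣X) (x∣y⇒x∣-y (x*x∣p⇒x∣θp g²∣X)))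

-- Division with remainder and Euclid's algorithm

DegreeBelow : ℕ → Poly → Set
DegreeBelow L p = ∀ i → coeff p (L ℕ.+ i) ≡ 0ℚ

degreeBelow-length : ∀ p → DegreeBelow (length p) p
degreeBelow-length []      i = refl
degreeBelow-length (a ∷ p) i = degreeBelow-length p i

degreeBelow-+ : ∀ {L p} m → DegreeBelow L p → DegreeBelow (L ℕ.+ m) p
degreeBelow-+ {L} {p} m deg i = trans (cong (coeff p) (ℕₚ.+-assoc L m i)) (deg (m ℕ.+ i))

degreeBelow-suc : ∀ {L p} → DegreeBelow (suc L) p → coeff p L ≡ 0ℚ → DegreeBelow L p
degreeBelow-suc {L} {p} deg pL≡0 zero    = trans (cong (coeff p) (ℕₚ.+-identityʳ L)) pL≡0
degreeBelow-suc {L} {p} deg pL≡0 (suc i) = trans (cong (coeff p) (ℕₚ.+-suc L i)) (deg i)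

coeff-qPow-*ₚ : ∀ j p i → coeff (qPow j *ₚ p) (j ℕ.+ i) ≡ coeff p i
coeff-qPow-*ₚ zero    p i = coeff-≡ (*ₚ-identityˡ p) i
coeff-qPow-*ₚ (suc j) p i = trans (coeff-≡ (0∷-*ₚ (qPow j) p) (suc (j ℕ.+ i))) (coeff-qPow-*ₚ j p i)

record DivisionWithRemainder (m : ℕ) (f g : Poly) : Set where
  constructor division
  field
    quotient   : Poly
    remainder  : Poly
    f≋qg+r     : f ≋ quotient *ₚ g +ₚ remainder
    remainder< : DegreeBelow m remainder

module _ {m g} (g≢0 : coeff g m ≢ 0ℚ) (deg-g : DegreeBelow (suc m) g) where

  private
    instance
      g-nonZero : ℚ.NonZero (coeff g m)
      g-nonZero = ℚ.≢-nonZero g≢0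

  leadingRatio : ℕ → Poly → ℚ
  leadingRatio j f = coeff f (j ℕ.+ m) *ℚ ℚ.1/ coeff g m

  leadingQuotient : ℕ → Poly → Poly
  leadingQuotient j f = scaleₚ (leadingRatio j f) (qPow j)

  leadingRatio-* : ∀ j f → leadingRatio j f *ℚ coeff g m ≡ coeff f (j ℕ.+ m)
  leadingRatio-* j f = begin
    (a *ℚ ℚ.1/ c) *ℚ c   ≡⟨ ℚₚ.*-assoc a (ℚ.1/ c) c ⟩
    a *ℚ (ℚ.1/ c *ℚ c)   ≡⟨ cong (a *ℚ_) (ℚₚ.*-inverseˡ c) ⟩
    a *ℚ 1ℚ              ≡⟨ ℚₚ.*-identityʳ a ⟩
    a                    ∎
    where
    open ≡-Reasoning
    a = coeff f (j ℕ.+ m)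
    c = coeff g m

  coeff-leadingQuotient-*ₚ : ∀ j f y →
                             coeff (leadingQuotient j f *ₚ g) (j ℕ.+ y) ≡ leadingRatio j f *ℚ coeff g y
  coeff-leadingQuotient-*ₚ j f y = begin
    coeff (scaleₚ k (qPow j) *ₚ g) (j ℕ.+ y)   ≡⟨ cong (λ p → coeff p (j ℕ.+ y)) (scaleₚ-*ₚ k (qPow j) g) ⟩
    coeff (scaleₚ k (qPow j *ₚ g)) (j ℕ.+ y)   ≡⟨ coeff-scaleₚ k (qPow j *ₚ g) (j ℕ.+ y) ⟩
    k *ℚ coeff (qPow j *ₚ g) (j ℕ.+ y)         ≡⟨ cong (k *ℚ_) (coeff-qPow-*ₚ j g y) ⟩
    k *ℚ coeff g y                             ∎
    where
    open ≡-Reasoning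
    k = leadingRatio j f

  eliminate-leading : ∀ j f → DegreeBelow (suc (j ℕ.+ m)) f →
                      DegreeBelow (j ℕ.+ m) (f -ₚ leadingQuotient j f *ₚ g)
  eliminate-leading j f deg-f i = begin
    coeff (f -ₚ t *ₚ g) (j ℕ.+ m ℕ.+ i)                  ≡⟨ cong (coeff (f -ₚ t *ₚ g)) (ℕₚ.+-assoc j m i) ⟩
    coeff (f -ₚ t *ₚ g) (j ℕ.+ (m ℕ.+ i))                ≡⟨ coeff--ₚ f (t *ₚ g) (j ℕ.+ (m ℕ.+ i)) ⟩
    coeff f (j ℕ.+ (m ℕ.+ i)) -ℚ coeff (t *ₚ g) (j ℕ.+ (m ℕ.+ i))
      ≡⟨ cong (coeff f (j ℕ.+ (m ℕ.+ i)) -ℚ_) (coeff-leadingQuotient-*ₚ j f (m ℕ.+ i)) ⟩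
    coeff f (j ℕ.+ (m ℕ.+ i)) -ℚ k *ℚ coeff g (m ℕ.+ i)  ≡⟨ vanish i ⟩
    0ℚ                                                   ∎
    where
    open ≡-Reasoning
    t = leadingQuotient j f
    k = leadingRatio j f

    vanish : ∀ i → coeff f (j ℕ.+ (m ℕ.+ i)) -ℚ k *ℚ coeff g (m ℕ.+ i) ≡ 0ℚ
    vanish zero rewrite ℕₚ.+-identityʳ m =
      trans (cong (coeff f (j ℕ.+ m) -ℚ_) (leadingRatio-* j f)) (ℚₚ.+-inverseʳ (coeff f (j ℕ.+ m)))
    vanish (suc i) = begin
      coeff f (j ℕ.+ (m ℕ.+ suc i)) -ℚ k *ℚ coeff g (m ℕ.+ suc i)
        ≡⟨ cong₂ (λ x y → x -ℚ k *ℚ y) f-vanishes g-vanishes ⟩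
      0ℚ -ℚ k *ℚ 0ℚ   ≡⟨ cong (0ℚ -ℚ_) (ℚₚ.*-zeroʳ k) ⟩
      0ℚ -ℚ 0ℚ        ≡⟨⟩
      0ℚ              ∎
      where
      f-vanishes : coeff f (j ℕ.+ (m ℕ.+ suc i)) ≡ 0ℚ
      f-vanishes = trans (cong (coeff f) (trans (sym (ℕₚ.+-assoc j m (suc i))) (ℕₚ.+-suc (j ℕ.+ m) i))) (deg-f i)
      g-vanishes : coeff g (m ℕ.+ suc i) ≡ 0ℚ
      g-vanishes = trans (cong (coeff g) (ℕₚ.+-suc m i)) (deg-g i)

  divide : ∀ j f → DegreeBelow (j ℕ.+ m) f → DivisionWithRemainder m f g
  divide zero    f deg-f = division [] f ≋-refl deg-f
  divide (suc j) f deg-f = division (quotient +ₚ t) remainder f≋[q+t]g+r remainder<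
    where
    t = leadingQuotient j f
    open DivisionWithRemainder (divide j (f -ₚ t *ₚ g) (eliminate-leading j f deg-f))
    open ≋-Reasoning

    f≋[q+t]g+r : f ≋ (quotient +ₚ t) *ₚ g +ₚ remainder
    f≋[q+t]g+r = begin
      f                                        ≈⟨ f≋[f-x]+x f (t *ₚ g) ⟩
      (f -ₚ t *ₚ g) +ₚ t *ₚ g                  ≈⟨ +ₚ-cong f≋qg+r ≋-refl ⟩
      (quotient *ₚ g +ₚ remainder) +ₚ t *ₚ g   ≈⟨ [qg+r]+tg≋[q+t]g+r quotient remainder t g ⟩
      (quotient +ₚ t) *ₚ g +ₚ remainder        ∎
      where
      f≋[f-x]+x : ∀ f x → f ≋ (f -ₚ x) +ₚ x
      f≋[f-x]+x = solve-∀ ℚ[q]-almostCommutativeRing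
      [qg+r]+tg≋[q+t]g+r : ∀ q r t g → (q *ₚ g +ₚ r) +ₚ t *ₚ g ≋ (q +ₚ t) *ₚ g +ₚ r
      [qg+r]+tg≋[q+t]g+r = solve-∀ ℚ[q]-almostCommutativeRing

  divMod : ∀ f → DivisionWithRemainder m f g
  divMod f = divide (length f) f (degreeBelow-+ {length f} {f} m (degreeBelow-length f))

record BezoutGcd (f g : Poly) : Set where
  constructor bezoutGcd
  field
    d       : Poly
    d∣f     : d ∣ʳ f
    d∣g     : d ∣ʳ g
    a b     : Poly
    af+bg≋d : a *ₚ f +ₚ b *ₚ g ≋ d

euclid-step : ∀ {f g r} s → f ≋ s *ₚ g +ₚ r → BezoutGcd g r → BezoutGcd f g
euclid-step {f} {g} {r} s f≋sg+r (bezoutGcd d d∣g d∣r a b ag+br≋d) =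
  bezoutGcd d d∣f d∣g b (a -ₚ b *ₚ s) (begin
    b *ₚ f +ₚ (a -ₚ b *ₚ s) *ₚ g                ≈⟨ +ₚ-cong (*ₚ-congˡ b f≋sg+r) ≋-refl ⟩
    b *ₚ (s *ₚ g +ₚ r) +ₚ (a -ₚ b *ₚ s) *ₚ g    ≈⟨ regroup a b s g r ⟩
    a *ₚ g +ₚ b *ₚ r                            ≈⟨ ag+br≋d ⟩
    d                                           ∎)
  where
  open ≋-Reasoning
  d∣f = ∣ʳ-respʳ-≈ (≋-sym f≋sg+r) (x∣y∧x∣z⇒x∣y+z (x∣ʳy⇒x∣ʳzy s d∣g) d∣r)
  regroup : ∀ a b s g r → b *ₚ (s *ₚ g +ₚ r) +ₚ (a -ₚ b *ₚ s) *ₚ g ≋ a *ₚ g +ₚ b *ₚ r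
  regroup = solve-∀ ℚ[q]-almostCommutativeRing

euclid : ∀ F f g → DegreeBelow F g → BezoutGcd f g
euclid zero    f g deg-g = bezoutGcd f ∣ʳ-refl (∣ʳ-respʳ-≈ (≋-sym (mk≋ deg-g)) (f ∣0)) oneₚ []
  (≋-trans (≋-reflexive (+ₚ-identityʳ (oneₚ *ₚ f))) (*ₚ-identityˡ f))
euclid (suc F) f g deg-g with coeff g F ℚₚ.≟ 0ℚ
... | yes gF≡0 = euclid F f g (degreeBelow-suc {F} {g} deg-g gF≡0)
... | no  gF≢0 = euclid-step quotient f≋qg+r (euclid F g remainder remainder<)
  where open DivisionWithRemainder (divMod {F} {g} gF≢0 deg-g f)

relPrime⇒bezout : ∀ C D → RelPrimeₚ C D → ∃₂ λ a b → a *ₚ C +ₚ b *ₚ D ≋ oneₚ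
relPrime⇒bezout C D C⊥D = scale-to-one (C⊥D d (∣ʳ⇒∣ₚ d∣f) (∣ʳ⇒∣ₚ d∣g))
  where
  open BezoutGcd (euclid (length D) C D (degreeBelow-length D))
  scale-to-one : IsUnitₚ d → ∃₂ λ a b → a *ₚ C +ₚ b *ₚ D ≋ oneₚ
  scale-to-one (u , ud≈1) = u *ₚ a , u *ₚ b , (begin
    (u *ₚ a) *ₚ C +ₚ (u *ₚ b) *ₚ D   ≈⟨ regroup u a b C D ⟩
    u *ₚ (a *ₚ C +ₚ b *ₚ D)          ≈⟨ *ₚ-congˡ u af+bg≋d ⟩
    u *ₚ d                           ≈⟨ mk≋ ud≈1 ⟩
    oneₚ                             ∎)
    where
    open ≋-Reasoning
    regroup : ∀ u a b C D → (u *ₚ a) *ₚ C +ₚ (u *ₚ b) *ₚ D ≋ u *ₚ (a *ₚ C +ₚ b *ₚ D)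
    regroup = solve-∀ ℚ[q]-almostCommutativeRing

relPrimeₚ-oneMinusQPow : ∀ N m n C D .{{_ : ℕ.NonZero N}} →
                         C *ₚ oneMinusQPow N ≈ₚ D *ₚ oneMinusQPow (m *ℕ n) →
                         RelPrimeₚ C D → RelPrimeₚ D (oneMinusQPow n)
relPrimeₚ-oneMinusQPow N m n C D CX≈DY C⊥D g g∣D g∣1-qⁿ =
  let a , b , aC+bD≋1 = relPrime⇒bezout C D C⊥D
      X               = oneMinusQPow N
      Y               = oneMinusQPow (m *ℕ n)
      g∣Y             = ∣ʳ-trans (∣ₚ⇒∣ʳ g∣1-qⁿ) (oneMinusQPow-∣-* m n)
  in ∣ʳ⇒∣ₚ (oneMinusQPow-squarefree N (x∣D∧x∣Y⇒x*x∣X a b C D X Y aC+bD≋1 (mk≋ CX≈DY) (∣ₚ⇒∣ʳ g∣D) g∣Y))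

open import Data.Nat.GCD using (gcd)
open import Data.Integer using (ℤ; +_; _+_; _-_; _*_; _≤_)
open import Data.Integer.Divisibility using (_∣_)

lemma4p4 : (n d : ℕ) → 1 ≤ℕ n → 2 ≤ℕ d → gcd n d ≡ 1 →
           (r : ℤ) → (+ d - + n) ≤ r → r ≤ + ((d ∸ 1) *ℕ n) → + d ∣ (+ n + r) →
           (k : ℕ) → 1 ≤ℕ k → + (d *ℕ k) ≤ + ((d ∸ 1) *ℕ n) - r →
           (C D : Poly) → ¬ (D ≈ₚ []) →
           C *ₚ oneMinusQPow (d *ℕ k) ≈ₚ D *ₚ oneMinusQPow ((d ∸ 1) *ℕ n) →
           RelPrimeₚ C D →
           RelPrimeₚ D (oneMinusQPow n)
lemma4p4 n d _ 2≤d _ _ _ _ _ k 1≤k _ C D _ CX≈DY C⊥D =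
  relPrimeₚ-oneMinusQPow (d *ℕ k) (d ∸ 1) n C D {{dk≢0}} CX≈DY C⊥D
  where
  dk≢0 : ℕ.NonZero (d *ℕ k)
  dk≢0 = ℕₚ.m*n≢0 d k {{ℕ.>-nonZero (ℕₚ.<-≤-trans ℕ.z<s 2≤d)}} {{ℕ.>-nonZero 1≤k}}
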